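{- Let $\mathcal{P}$ be a profile of unrooted phylogenetic trees whose display graph $G(\mathcal{P})$ is connected. Then $G(\mathcal{P})$ has a complete set of pairwise parallel nice minimal cuts if and only if it has a complete set of pairwise parallel legal minimal cuts.
   Context: A phylogenetic tree is an unrooted tree whose leaves are bijectively labelled by a finite label set; leaves are identified with labels. A profile is a finite collection $\mathcal{P}=\{T_1,\dots,T_k\}$ of phylogenetic trees with pairwise disjoint sets of internal vertices. The display graph $G(\mathcal{P})$ has vertex set $\bigcup_iV(T_i)$ and edge set $\bigcup_iE(T_i)$. An edge of an input tree is internal if both endpoints are internal (non-leaf) vertices. A cut of a connected graph $G$ is $F\subseteq E(G)$ with $G-F$ disconnected; minimal if no proper subset is a cut. Cuts $F,F'$ are parallel if $G-F$ has at most one connected component $H$ with $E(H)\cap F'\neq\emptyset$. $\mathrm{Inc}(u)$ is the set of edges of $G(\mathcal{P})$ incident to $u$. A cut $F$ of $G(\mathcal{P})$ is legal if for each $T\in\mathcal{P}$ there is $u\in V(T)$ with $F\cap E(T)\subseteq\mathrm{Inc}(u)$, and nice if it is legal and each connected component of $G(\mathcal{P})-F$ has at least one edge. A set $\mathcal{F}$ of cuts is complete if for every $T\in\mathcal{P}$ and every internal edge $e$ of $T$ there is $F\in\mathcal{F}$ with $F\cap E(T)=\{e\}$. -}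

module Defs where

open import Data.Nat using (ℕ; _≤_)
open import Data.Fin using (Fin)
open import Data.Bool using (Bool; true; false)
open import Data.List using (List; length; _++_; take)
open import Data.List.Relation.Unary.Linked using (Linked)
open import Data.List.Relation.Unary.Unique.Propositional using (Unique)
open import Data.List.Membership.Propositional using (_∈_)
open import Data.Product using (Σ; ∃; _×_; _,_)
open import Data.Sum using (_⊎_)
open import Data.Empty using (⊥)
open import Relation.Nullary using (¬_)
open import Relation.Binary.PropositionalEquality using (_≡_)

-- A set of (undirected) edges on Fin n, given by a Boolean characteristic
-- function on ordered pairs; undirected edge sets are required to be
-- symmetric (see Sym).
EdgeSet : ℕ → Set
EdgeSet n = Fin n → Fin n → Bool

Sym : ∀ {n} → EdgeSet n → Set
Sym F = ∀ u v → F u v ≡ F v u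

data Reach {n : ℕ} (R : Fin n → Fin n → Set) : Fin n → Fin n → Set where
  here : ∀ {u} → Reach R u u
  step : ∀ {u v w} → R u v → Reach R v w → Reach R u w

-- A cycle: a list of ≥ 3 distinct vertices, consecutive ones adjacent,
-- and the last adjacent to the first.
HasCycle : ∀ {n} → (Fin n → Fin n → Set) → Set
HasCycle {n} R = Σ (List (Fin n)) λ xs →
  Unique xs × (3 ≤ length xs) × Linked R (xs ++ take 1 xs)

-- Profiles of unrooted phylogenetic trees, given directly inside their
-- display graph.  The vertices of the display graph are Fin n; the
-- vertices with isLabel ≡ true are the labels (leaves), all others are
-- internal vertices of exactly one tree.

record Profile (n k : ℕ) : Set where
  field
    isLabel : Fin n → Bool
    VT      : Fin k → Fin n → Bool
    ET      : Fin k → EdgeSet n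
    ET-sym  : ∀ i → Sym (ET i)
    ET-loop : ∀ i u → ET i u u ≡ false
    ET-in   : ∀ i u v → ET i u v ≡ true → VT i u ≡ true
    VT-ne   : ∀ i → ∃ λ v → VT i v ≡ true
    T-conn  : ∀ i u v → VT i u ≡ true → VT i v ≡ true →
              Reach (λ a b → ET i a b ≡ true) u v
    T-acyc  : ∀ i → ¬ HasCycle (λ a b → ET i a b ≡ true)
    -- the leaves (vertices of degree ≤ 1) of T i are exactly its labelled
    -- vertices (leaves are identified with their labels)
    T-leaf  : ∀ i v → VT i v ≡ true →
              (isLabel v ≡ true →
                 ∀ w w' → ET i v w ≡ true → ET i v w' ≡ true → w ≡ w')
            × ((∀ w w' → ET i v w ≡ true → ET i v w' ≡ true → w ≡ w') →
                 isLabel v ≡ true)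
    int-disj : ∀ i j v → isLabel v ≡ false → VT i v ≡ true → VT j v ≡ true → i ≡ j
    covered  : ∀ v → ∃ λ i → VT i v ≡ true

module _ {n k : ℕ} (P : Profile n k) where
  open Profile P

  EG : Fin n → Fin n → Set
  EG u v = ∃ λ i → ET i u v ≡ true

  DisplayConnected : Set
  DisplayConnected = ∀ u v → Reach EG u v

  EminusF : EdgeSet n → Fin n → Fin n → Set
  EminusF F u v = EG u v × F u v ≡ false

  IsCut : EdgeSet n → Set
  IsCut F = Sym F × (∀ u v → F u v ≡ true → EG u v)
          × ¬ (∀ u v → Reach (EminusF F) u v)

  _⊂E_ : EdgeSet n → EdgeSet n → Set
  F' ⊂E F = (∀ u v → F' u v ≡ true → F u v ≡ true)
          × (∃ λ u → ∃ λ v → F u v ≡ true × F' u v ≡ false)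

  IsMinimalCut : EdgeSet n → Set
  IsMinimalCut F = IsCut F × (∀ F' → F' ⊂E F → ¬ IsCut F')

  -- F, F' parallel: at most one component H of G − F has an edge of F'.
  -- (Edges of G − F with both endpoints in a component lie in it.)
  Parallel : EdgeSet n → EdgeSet n → Set
  Parallel F F' = ∀ a b c d →
    EminusF F a b → F' a b ≡ true →
    EminusF F c d → F' c d ≡ true →
    Reach (EminusF F) a c

  IsLegal : EdgeSet n → Set
  IsLegal F = IsCut F × (∀ i → ∃ λ u → VT i u ≡ true ×
    (∀ a b → F a b ≡ true → ET i a b ≡ true → a ≡ u ⊎ b ≡ u))

  IsNice : EdgeSet n → Set
  IsNice F = IsLegal F ×
    (∀ x → ∃ λ a → ∃ λ b → Reach (EminusF F) x a × EminusF F a b)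

  Complete : List (EdgeSet n) → Set
  Complete 𝓕 = ∀ i a b → ET i a b ≡ true → isLabel a ≡ false → isLabel b ≡ false →
    ∃ λ F → F ∈ 𝓕 × (∀ c d →
      ((F c d ≡ true × ET i c d ≡ true) → (c ≡ a × d ≡ b) ⊎ (c ≡ b × d ≡ a))
      × ((c ≡ a × d ≡ b) ⊎ (c ≡ b × d ≡ a) → (F c d ≡ true × ET i c d ≡ true)))

  HasCompleteParallel : (EdgeSet n → Set) → Set
  HasCompleteParallel Q = ∃ λ (𝓕 : List (EdgeSet n)) →
    (∀ F → F ∈ 𝓕 → Q F × IsMinimalCut F)
    × (∀ F F' → F ∈ 𝓕 → F' ∈ 𝓕 → Parallel F F')
    × Complete 𝓕

module Submission where

-- Every nice cut is legal, so one direction is immediate.  For the other,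
-- the only way a legal cut F can fail to be nice is that G(P) − F has a
-- component without edges, i.e. a vertex x isolated in G(P) − F.
-- Hence discarding the isolating cuts from a complete set of pairwise
-- parallel legal minimal cuts leaves a complete set of pairwise parallel
-- nice minimal cuts.

open import Defs
open import Data.Nat using (ℕ)
open import Function.Bundles using (_⇔_; mk⇔)
open import Data.Fin using (Fin; _≟_)
open import Data.Fin.Properties using (any?; all?)
open import Data.Bool using (true; false; _∧_; _∨_)
open import Data.Bool.Properties using (∨-comm; ∧-conicalˡ; ∧-conicalʳ)
import Data.Bool.Properties as Bool
open import Data.List using (filter)
open import Data.List.Membership.Propositional using (_∈_)
open import Data.List.Membership.Propositional.Properties using (∈-filter⁺; ∈-filter⁻)
open import Data.Product using (∃; _×_; _,_; proj₁; proj₂)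
open import Data.Sum using (_⊎_; inj₁; inj₂)
import Data.Sum as Sum
open import Data.Empty using (⊥; ⊥-elim)
open import Relation.Nullary using (¬_; Dec; yes; no; does)
open import Relation.Nullary.Decidable using (_×-dec_; ¬?)
open import Relation.Binary.PropositionalEquality using (_≡_; refl; sym; trans; subst; cong₂)

module _ {n k : ℕ} (P : Profile n k) where
  open Profile P

  Isolated : EdgeSet n → Fin n → Set
  Isolated F x = ∀ v → ¬ EminusF P F x v

  Isolating : EdgeSet n → Set
  Isolating F = ∃ λ x → Isolated F x

  isEdge? : ∀ u v → Dec (EG P u v)
  isEdge? u v = any? (λ i → ET i u v Bool.≟ true)

  isolated? : ∀ F x → Dec (Isolated F x)
  isolated? F x = all? (λ v → ¬? (isEdge? x v ×-dec (F x v Bool.≟ false)))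

  notIsolating? : ∀ F → Dec (¬ Isolating F)
  notIsolating? F = ¬? (any? (isolated? F))

  isolated⇒cut-edge : ∀ {F x v} → Isolated F x → EG P x v → F x v ≡ true
  isolated⇒cut-edge {F} {x} {v} iso e with F x v in eq
  ... | true  = refl
  ... | false = ⊥-elim (iso v (e , eq))

  isolated-unreachable : ∀ {F x y} → Isolated F x → Reach (EminusF P F) x y → y ≡ x
  isolated-unreachable iso here                = refl
  isolated-unreachable iso (step {v = v} e _) = ⊥-elim (iso v e)

  legal⇒nice : ∀ F → IsLegal P F → ¬ Isolating F → IsNice P F
  legal⇒nice F legal noIso = legal , λ x → x , edgeAt x
    where
    edgeAt : ∀ x → ∃ λ b → Reach (EminusF P F) x x × EminusF P F x b
    edgeAt x with any? (λ v → isEdge? x v ×-dec (F x v Bool.≟ false))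
    ... | yes (b , e) = b , here , e
    ... | no none     = ⊥-elim (noIso (x , λ v e → none (v , e)))

  minimal⇒sub-cut-full : ∀ {F F'} → IsMinimalCut P F → (∀ u v → F' u v ≡ true → F u v ≡ true) →
                         IsCut P F' → ∀ u v → F u v ≡ true → F' u v ≡ true
  minimal⇒sub-cut-full {F} {F'} (_ , minimal) F'⊆F F'-cut u v Fuv with F' u v in eq
  ... | true  = refl
  ... | false = ⊥-elim (minimal F' (F'⊆F , u , v , Fuv , eq) F'-cut)

  touches : Fin n → EdgeSet n
  touches x u v = does (u ≟ x) ∨ does (v ≟ x)

  touches-self : ∀ x v → touches x x v ≡ true
  touches-self x v with x ≟ x
  ... | yes _  = refl
  ... | no x≢x = ⊥-elim (x≢x refl)

  touches-sound : ∀ x u v → touches x u v ≡ true → u ≡ x ⊎ v ≡ x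
  touches-sound x u v with u ≟ x | v ≟ x
  ... | yes u≡x | _       = λ _ → inj₁ u≡x
  ... | no _    | yes v≡x = λ _ → inj₂ v≡x
  ... | no _    | no _    = λ ()

  restrictTo : Fin n → EdgeSet n → EdgeSet n
  restrictTo x F u v = F u v ∧ touches x u v

  -- If x is isolated in G(P) − F for a cut F, then F ∩ Inc(x) is still a cut:
  -- x stays isolated, and if G(P) − (F ∩ Inc(x)) were connected then every
  -- vertex would equal x, making G(P) − F connected too.
  restrict-isolated-cut : ∀ {F x} → IsCut P F → Isolated F x → IsCut P (restrictTo x F)
  restrict-isolated-cut {F} {x} (F-sym , F⊆G , disconnected) iso =
      (λ u v → cong₂ _∧_ (F-sym u v) (∨-comm (does (u ≟ x)) (does (v ≟ x))))
    , (λ u v e → F⊆G u v (∧-conicalˡ _ _ e))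
    , λ connected → disconnected λ u v →
        subst (Reach (EminusF P F) u) (trans (onlyX u connected) (sym (onlyX v connected))) here
    where
    stillIsolated : Isolated (restrictTo x F) x
    stillIsolated v (e , notCut) =
      ¬true≡false (trans (sym (cong₂ _∧_ (isolated⇒cut-edge {F} {x} iso e) (touches-self x v))) notCut)
      where
      ¬true≡false : true ≡ false → ⊥
      ¬true≡false ()
    onlyX : ∀ y → (∀ u v → Reach (EminusF P (restrictTo x F)) u v) → y ≡ x
    onlyX y connected = isolated-unreachable {restrictTo x F} {x} stillIsolated (connected x y)

  minimal-isolating⇒star : ∀ {F x} → IsMinimalCut P F → Isolated F x →
                            ∀ u v → F u v ≡ true → u ≡ x ⊎ v ≡ x
  minimal-isolating⇒star {F} {x} mc iso u v Fuv =
    touches-sound x u v (∧-conicalʳ _ _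
      (minimal⇒sub-cut-full mc (λ a b e → ∧-conicalˡ _ _ e)
        (restrict-isolated-cut (proj₁ mc) iso) u v Fuv))

  SeparatesOnly : EdgeSet n → Fin k → Fin n → Fin n → Set
  SeparatesOnly F i a b = ∀ c d →
      ((F c d ≡ true × ET i c d ≡ true) → (c ≡ a × d ≡ b) ⊎ (c ≡ b × d ≡ a))
    × ((c ≡ a × d ≡ b) ⊎ (c ≡ b × d ≡ a) → (F c d ≡ true × ET i c d ≡ true))

  separatesOnly-swap : ∀ {F i a b} → SeparatesOnly F i a b → SeparatesOnly F i b a
  separatesOnly-swap only c d =
    (λ e → Sum.swap (proj₁ (only c d) e)) , (λ e → proj₂ (only c d) (Sum.swap e))

  internal⇒not-pendant : ∀ i a b → VT i a ≡ true → isLabel a ≡ false →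
                          ¬ (∀ w → ET i a w ≡ true → w ≡ b)
  internal⇒not-pendant i a b a∈T internal pendant
    with trans (sym internal) (proj₂ (T-leaf i a a∈T)
           (λ w w' e e' → trans (pendant w e) (sym (pendant w' e'))))
  ... | ()

  -- If a is isolated in G(P) − F and F ∩ E(T_i) = {ab}, then ab is the only
  -- T_i-edge at a, so a is a leaf of T_i.
  isolated-endpoint⇒leaf : ∀ {F i a b} → Isolated F a → ET i a b ≡ true →
                            isLabel a ≡ false → SeparatesOnly F i a b → ⊥
  isolated-endpoint⇒leaf {F} {i} {a} {b} iso ab∈T internal only =
    internal⇒not-pendant i a b (ET-in i a b ab∈T) internal onlyNeighbour
    where
    noLoop : a ≡ b → ⊥
    noLoop refl with trans (sym ab∈T) (ET-loop i a)
    ... | ()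
    onlyNeighbour : ∀ w → ET i a w ≡ true → w ≡ b
    onlyNeighbour w aw∈T with proj₁ (only a w) (isolated⇒cut-edge {F} {a} iso (i , aw∈T) , aw∈T)
    ... | inj₁ (_ , w≡b)   = w≡b
    ... | inj₂ (a≡b , _)   = ⊥-elim (noLoop a≡b)

  -- A minimal cut F with F ∩ E(T_i) = {ab} for an internal edge ab isolates
  -- no vertex: by the star lemma ab would be incident to the isolated vertex.
  separating-internal⇒not-isolating : ∀ {F i a b} → IsMinimalCut P F → ET i a b ≡ true →
    isLabel a ≡ false → isLabel b ≡ false → SeparatesOnly F i a b → ¬ Isolating F
  separating-internal⇒not-isolating {F} {i} {a} {b} mc ab∈T a-int b-int only (x , iso)
    with minimal-isolating⇒star mc iso a b (proj₁ (proj₂ (only a b) (inj₁ (refl , refl))))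
  ... | inj₁ refl = isolated-endpoint⇒leaf iso ab∈T a-int only
  ... | inj₂ refl = isolated-endpoint⇒leaf iso (trans (ET-sym i b a) ab∈T) b-int
                                           (separatesOnly-swap only)

  nice⇒legal-family : HasCompleteParallel P (IsNice P) → HasCompleteParallel P (IsLegal P)
  nice⇒legal-family (𝓕 , good , parallel , complete) =
    𝓕 , (λ F F∈ → proj₁ (proj₁ (good F F∈)) , proj₂ (good F F∈)) , parallel , complete

  legal⇒nice-family : HasCompleteParallel P (IsLegal P) → HasCompleteParallel P (IsNice P)
  legal⇒nice-family (𝓕 , good , parallel , complete) =
      filter notIsolating? 𝓕
    , (λ F F∈ → let (F∈𝓕 , noIso) = ∈-filter⁻ notIsolating? F∈ in
                legal⇒nice F (proj₁ (good F F∈𝓕)) noIso , proj₂ (good F F∈𝓕))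
    , (λ F F' F∈ F'∈ → parallel F F' (proj₁ (∈-filter⁻ notIsolating? F∈))
                                     (proj₁ (∈-filter⁻ notIsolating? F'∈)))
    , λ i a b ab∈T a-int b-int →
        let (F , F∈𝓕 , only) = complete i a b ab∈T a-int b-int in
        F , ∈-filter⁺ notIsolating? F∈𝓕
              (separating-internal⇒not-isolating (proj₂ (good F F∈𝓕)) ab∈T a-int b-int only)
          , only

lemma8 : ∀ {n k : ℕ} (P : Profile n k) → DisplayConnected P →
    (HasCompleteParallel P (IsNice P) ⇔ HasCompleteParallel P (IsLegal P))
lemma8 P _ = mk⇔ (nice⇒legal-family P) (legal⇒nice-family P)
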